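{- For every formula $\varphi$ of $\mu\mathtt{NML}$ and every second-order variable $p$, there is a formula $\mathtt{Eq}(\varphi,p)$ of $\mathtt{NMSO}$ such that for every monotone neighborhood model $\mathbb{S}=(S,\sigma,V)$ and every $s\in S$, $$(\mathbb{S},s)\vDash \mathtt{Eq}(\varphi,p) \iff V(p) = \{u\in S \mid (\mathbb{S},u)\vDash\varphi\}.$$
   Context: A monotone neighborhood model is $\mathbb{S}=(S,\sigma,V)$ with $\sigma:S\to\mathcal{P}\mathcal{P}(S)$ upward closed ($Z\in\sigma(s)$, $Z\subseteq Z'$ imply $Z'\in\sigma(s)$) and $V:\mathit{Var}\to\mathcal{P}(S)$ a valuation. $\mu\mathtt{NML}$ is the monotone modal $\mu$-calculus in negation normal form: $\varphi ::= p\mid\neg p\mid\varphi\wedge\varphi\mid\varphi\vee\varphi\mid\Box\varphi\mid\Diamond\varphi\mid\mu p.\varphi\mid\nu p.\varphi$, where the extension of $\Box\varphi$ is the set of $u$ such that the extension of $\varphi$ belongs to $\sigma(u)$, the extension of $\Diamond\varphi$ is the set of $u$ such that the complement of the extension of $\varphi$ does not belong to $\sigma(u)$, and $\mu,\nu$ give least and greatest fixpoints. $\mathtt{NMSO}$ is the monadic second-order language $\varphi ::= sr(p)\mid p\subseteq q\mid \Box(p,q)\mid \varphi\vee\varphi\mid\varphi\wedge\varphi\mid\neg\varphi\mid\exists p.\varphi$ with $(\mathbb{S},s)\vDash sr(p)$ iff $V(p)=\{s\}$, $p\subseteq q$ iff $V(p)\subseteq V(q)$, $\Box(p,q)$ iff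 $V(q)\in\sigma(t)$ for all $t\in V(p)$, and $\exists p$ ranging over subsets of $S$. -}

module Defs where

open import Level using (0ℓ)
open import Data.Nat using (ℕ; _≡ᵇ_)
open import Data.Bool using (Bool; true; false; not; if_then_else_)
open import Data.Product using (Σ; _×_)
open import Data.Empty using (⊥)
open import Relation.Nullary using (¬_; Dec; does)
open import Relation.Binary.PropositionalEquality using (_≡_)
open import Axiom.ExcludedMiddle using (ExcludedMiddle)

Var : Set
Var = ℕ

-- Subsets of S are characteristic functions S → Bool (classical reading;
-- made meaningful by the excluded-middle hypothesis below).
Subset : Set → Set
Subset S = S → Bool

_∈_ : {S : Set} → S → Subset S → Set
u ∈ Z = Z u ≡ true

_⊆_ : {S : Set} → Subset S → Subset S → Set
Z ⊆ Z' = ∀ u → u ∈ Z → u ∈ Z'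

record MonFrame : Set₁ where
  field
    S       : Set
    σ       : S → Subset S → Set
    upward  : ∀ {s : S} {Z Z' : Subset S} → σ s Z → Z ⊆ Z' → σ s Z'
open MonFrame public

Valuation : MonFrame → Set
Valuation F = Var → Subset (S F)

_[_↦_] : {F : MonFrame} → Valuation F → Var → Subset (S F) → Valuation F
(V [ p ↦ Z ]) q = if q ≡ᵇ p then Z else V q

data μNML : Set where
  var    : Var → μNML
  nvar   : Var → μNML
  _∧′_   : μNML → μNML → μNML
  _∨′_   : μNML → μNML → μNML
  □′     : μNML → μNML
  ◇′     : μNML → μNML
  μ′     : Var → μNML → μNML
  ν′     : Var → μNML → μNML

module _ (lem : ExcludedMiddle 0ℓ) where
  ⌊_⌋ : Set → Bool
  ⌊ P ⌋ = does (lem {P})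

  ext : (F : MonFrame) → Valuation F → μNML → Subset (S F)
  ext F V (var p)   u = V p u
  ext F V (nvar p)  u = not (V p u)
  ext F V (φ ∧′ ψ)  u = ⌊ (u ∈ ext F V φ) × (u ∈ ext F V ψ) ⌋
  ext F V (φ ∨′ ψ)  u = ⌊ (u ∈ ext F V φ) Data.Sum.⊎ (u ∈ ext F V ψ) ⌋
    where import Data.Sum
  ext F V (□′ φ)    u = ⌊ σ F u (ext F V φ) ⌋
  ext F V (◇′ φ)    u = ⌊ ¬ σ F u (λ w → not (ext F V φ w)) ⌋
  -- least fixpoint: intersection of all prefixpoints (Knaster–Tarski)
  ext F V (μ′ p φ)  u =
    ⌊ ((Z : Subset (S F)) → ext F (_[_↦_] {F} V p Z) φ ⊆ Z → u ∈ Z) ⌋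
  -- greatest fixpoint: union of all postfixpoints
  ext F V (ν′ p φ)  u =
    ⌊ Σ (Subset (S F)) (λ Z → (Z ⊆ ext F (_[_↦_] {F} V p Z) φ) × (u ∈ Z)) ⌋

data NMSO : Set where
  sr    : Var → NMSO
  _⊆′_  : Var → Var → NMSO
  □²    : Var → Var → NMSO
  _∨ₘ_  : NMSO → NMSO → NMSO
  _∧ₘ_  : NMSO → NMSO → NMSO
  ¬ₘ    : NMSO → NMSO
  ∃ₘ    : Var → NMSO → NMSO

_⊨_,_⊢_ : (F : MonFrame) → Valuation F → S F → NMSO → Set
F ⊨ V , s ⊢ sr p      = ∀ u → (u ∈ V p → u ≡ s) × (u ≡ s → u ∈ V p)
F ⊨ V , s ⊢ (p ⊆′ q)  = V p ⊆ V q
F ⊨ V , s ⊢ □² p q    = ∀ t → t ∈ V p → σ F t (V q)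
F ⊨ V , s ⊢ (φ ∨ₘ ψ)  = (F ⊨ V , s ⊢ φ) Data.Sum.⊎ (F ⊨ V , s ⊢ ψ)
  where import Data.Sum
F ⊨ V , s ⊢ (φ ∧ₘ ψ)  = (F ⊨ V , s ⊢ φ) × (F ⊨ V , s ⊢ ψ)
F ⊨ V , s ⊢ ¬ₘ φ      = ¬ (F ⊨ V , s ⊢ φ)
F ⊨ V , s ⊢ ∃ₘ p φ    = Σ (Subset (S F)) (λ Z → F ⊨ (_[_↦_] {F} V p Z) , s ⊢ φ)

{-# OPTIONS --safe #-}
-- Each connective of μNML is a set operation that NMSO can characterise
-- extremally: A ∩ B is the largest set inside A and B, A ∪ B the least set
-- containing both, ∁ A the largest set disjoint from A, the □-image of A the
-- largest set all of whose points have A as a neighbourhood, and ◇ = ∁ □ ∁.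
-- Such a formula pins its variable to a unique set, so ∃ x (α ∧ β) acts as
-- "β where x := the set defined by α"; composing these along φ gives Eq(φ, p).
-- By Knaster–Tarski, X ⊆ μq.φ iff X lies in every prefixed point of
-- Z ↦ ⟦φ⟧[q ↦ Z]; the prefixed points are quantified over with a universally
-- quantified copy of Eq(φ, ·), and μq.φ is the largest such X (dually for ν).
module Submission where

open import Defs hiding (⌊_⌋; _[_↦_])
open import Level using (0ℓ)
open import Axiom.ExcludedMiddle using (ExcludedMiddle)
open import Axiom.DoubleNegationElimination using (em⇒dne)
open import Data.Bool using (Bool; true; false; not)
open import Data.Nat using (ℕ; suc; _+_; _<_; _≤_; _⊔_; _≡ᵇ_)
open import Data.Nat.Properties
  using (≤-refl; ≤-trans; <-≤-trans; n≤1+n; n<1+n; m<n⇒m<1+n; m≤m⊔n; m≤n⊔m; <⇒≢; >⇒≢; ≡ᵇ⇒≡; ≡⇒≡ᵇ)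
open import Data.Product using (Σ; _×_; _,_; proj₁; proj₂)
open import Data.Product.Function.NonDependent.Propositional using (_×-⇔_)
open import Data.Sum using (_⊎_; inj₁; inj₂; [_,_]′)
open import Data.Sum.Function.Propositional using (_⊎-⇔_)
open import Data.Unit using (tt)
open import Data.Empty using (⊥)
open import Function.Base using (_∘_; id; case_of_)
open import Function.Bundles using (_⇔_; mk⇔; Equivalence)
open import Function.Construct.Composition using (_⇔-∘_)
open import Function.Properties.Equivalence using (⇔-setoid)
open import Function.Related.TypeIsomorphisms using (→-cong-⇔; ¬-cong-⇔)
open import Relation.Binary.Bundles using (Setoid)
open import Relation.Binary.PropositionalEquality
  using (_≡_; _≢_; _≗_; refl; sym; trans; cong; cong-app; _→-setoid_)
open import Relation.Nullary using (¬_; yes; no; contradiction)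
open import Relation.Nullary.Decidable using (does-⇔; does-≡; ¬?)

open Equivalence using (to; from)

-- Derived formulas and the translation

infixr 5 _⇒ₘ_

_⇒ₘ_ : NMSO → NMSO → NMSO
χ ⇒ₘ ξ = ¬ₘ χ ∨ₘ ξ

∀ₘ : Var → NMSO → NMSO
∀ₘ x χ = ¬ₘ (∃ₘ x (¬ₘ χ))

_≐ₘ_ : Var → Var → NMSO
x ≐ₘ y = (x ⊆′ y) ∧ₘ (y ⊆′ x)

Let : Var → NMSO → NMSO → NMSO
Let x α β = ∃ₘ x (α ∧ₘ β)

IsEmpty : Var → Var → NMSO
IsEmpty y w = ∀ₘ w (y ⊆′ w)

IsGreatest : Var → Var → NMSO → NMSO
IsGreatest p x χ = ∃ₘ x ((x ≐ₘ p) ∧ₘ χ) ∧ₘ ∀ₘ x (χ ⇒ₘ (x ⊆′ p))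

IsLeast : Var → Var → NMSO → NMSO
IsLeast p x χ = ∀ₘ x (χ ⇒ₘ (p ⊆′ x)) ∧ₘ ∃ₘ x ((x ≐ₘ p) ∧ₘ χ)

Disjoint : Var → Var → Var → Var → NMSO
Disjoint x a y w = ∀ₘ y (((y ⊆′ x) ∧ₘ (y ⊆′ a)) ⇒ₘ IsEmpty y w)

-- In the formulas below taking a last argument k, the variables k, 1 + k, …
-- are auxiliary and all other arguments must be smaller than k.

IsInter : Var → Var → Var → ℕ → NMSO
IsInter p a b k = IsGreatest p k ((k ⊆′ a) ∧ₘ (k ⊆′ b))

IsUnion : Var → Var → Var → ℕ → NMSO
IsUnion p a b k = IsLeast p k ((a ⊆′ k) ∧ₘ (b ⊆′ k))

IsCompl : Var → Var → ℕ → NMSO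
IsCompl p a k = IsGreatest p k (Disjoint k a (1 + k) (2 + k))

Is□ : Var → Var → ℕ → NMSO
Is□ p a k = IsGreatest p k (□² k a)

Is◇ : Var → Var → ℕ → NMSO
Is◇ p a k = Let k (IsCompl k a (1 + k)) (Let (1 + k) (Is□ (1 + k) k (2 + k)) (IsCompl p (1 + k) (2 + k)))

Eq : μNML → Var → ℕ → NMSO
BelowPrefixed : Var → μNML → ℕ → NMSO
AbovePostfixed : Var → μNML → ℕ → NMSO

Eq (var q)  a k = a ≐ₘ q
Eq (nvar q) a k = IsCompl a q k
Eq (φ ∧′ ψ) a k = Let k (Eq φ k (2 + k)) (Let (1 + k) (Eq ψ (1 + k) (2 + k)) (IsInter a k (1 + k) (2 + k)))
Eq (φ ∨′ ψ) a k = Let k (Eq φ k (2 + k)) (Let (1 + k) (Eq ψ (1 + k) (2 + k)) (IsUnion a k (1 + k) (2 + k)))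
Eq (□′ φ)   a k = Let k (Eq φ k (1 + k)) (Is□ a k (1 + k))
Eq (◇′ φ)   a k = Let k (Eq φ k (1 + k)) (Is◇ a k (1 + k))
Eq (μ′ q φ) a k = IsGreatest a k (BelowPrefixed q φ k)
Eq (ν′ q φ) a k = IsLeast a k (AbovePostfixed q φ k)

BelowPrefixed q φ k = ∀ₘ q (∀ₘ (1 + k) (Eq φ (1 + k) (2 + k) ⇒ₘ (((1 + k) ⊆′ q) ⇒ₘ (k ⊆′ q))))
AbovePostfixed q φ k = ∀ₘ q (∀ₘ (1 + k) (Eq φ (1 + k) (2 + k) ⇒ₘ ((q ⊆′ (1 + k)) ⇒ₘ (q ⊆′ k))))

Below : ℕ → μNML → Set
Below n (var q)  = q < n
Below n (nvar q) = q < n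
Below n (φ ∧′ ψ) = Below n φ × Below n ψ
Below n (φ ∨′ ψ) = Below n φ × Below n ψ
Below n (□′ φ)   = Below n φ
Below n (◇′ φ)   = Below n φ
Below n (μ′ q φ) = q < n × Below n φ
Below n (ν′ q φ) = q < n × Below n φ

Below-mono : ∀ {m n} φ → m ≤ n → Below m φ → Below n φ
Below-mono (var q)  m≤n q<m        = <-≤-trans q<m m≤n
Below-mono (nvar q) m≤n q<m        = <-≤-trans q<m m≤n
Below-mono (φ ∧′ ψ) m≤n (bφ , bψ)  = Below-mono φ m≤n bφ , Below-mono ψ m≤n bψ
Below-mono (φ ∨′ ψ) m≤n (bφ , bψ)  = Below-mono φ m≤n bφ , Below-mono ψ m≤n bψ
Below-mono (□′ φ)   m≤n bφ         = Below-mono φ m≤n bφ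
Below-mono (◇′ φ)   m≤n bφ         = Below-mono φ m≤n bφ
Below-mono (μ′ q φ) m≤n (q<m , bφ) = <-≤-trans q<m m≤n , Below-mono φ m≤n bφ
Below-mono (ν′ q φ) m≤n (q<m , bφ) = <-≤-trans q<m m≤n , Below-mono φ m≤n bφ

bound : μNML → ℕ
bound (var q)  = suc q
bound (nvar q) = suc q
bound (φ ∧′ ψ) = bound φ ⊔ bound ψ
bound (φ ∨′ ψ) = bound φ ⊔ bound ψ
bound (□′ φ)   = bound φ
bound (◇′ φ)   = bound φ
bound (μ′ q φ) = suc q ⊔ bound φ
bound (ν′ q φ) = suc q ⊔ bound φ

Below-bound : ∀ φ → Below (bound φ) φ
Below-bound (var q)  = ≤-refl
Below-bound (nvar q) = ≤-refl
Below-bound (φ ∧′ ψ) = Below-mono φ (m≤m⊔n _ _) (Below-bound φ) , Below-mono ψ (m≤n⊔m _ _) (Below-bound ψ)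
Below-bound (φ ∨′ ψ) = Below-mono φ (m≤m⊔n _ _) (Below-bound φ) , Below-mono ψ (m≤n⊔m _ _) (Below-bound ψ)
Below-bound (□′ φ)   = Below-bound φ
Below-bound (◇′ φ)   = Below-bound φ
Below-bound (μ′ q φ) = m≤m⊔n (suc q) (bound φ) , Below-mono φ (m≤n⊔m _ _) (Below-bound φ)
Below-bound (ν′ q φ) = m≤m⊔n (suc q) (bound φ) , Below-mono φ (m≤n⊔m _ _) (Below-bound φ)

k<2+k : ∀ k → k < 2 + k
k<2+k k = m<n⇒m<1+n (n<1+n k)

k≤2+k : ∀ k → k ≤ 2 + k
k≤2+k k = ≤-trans (n≤1+n k) (n≤1+n (1 + k))

Π-cong-⇔ : ∀ {a} {A : Set a} {P Q : A → Set} → (∀ a → P a ⇔ Q a) → (∀ a → P a) ⇔ (∀ a → Q a)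
Π-cong-⇔ P⇔Q = mk⇔ (λ h a → to (P⇔Q a) (h a)) (λ h a → from (P⇔Q a) (h a))

module _ (lem : ExcludedMiddle 0ℓ) where

  private variable
    P Q : Set

  ⌊_⌋ : Set → Bool
  ⌊ P ⌋ = Defs.⌊_⌋ lem P

  ⌊⌋-true : (⌊ P ⌋ ≡ true) ⇔ P
  ⌊⌋-true {P} with lem {P}
  ... | yes p = mk⇔ (λ _ → p) (λ _ → refl)
  ... | no ¬p = mk⇔ (λ ()) (λ p → contradiction p ¬p)

  ⌊⌋-cong : P ⇔ Q → ⌊ P ⌋ ≡ ⌊ Q ⌋
  ⌊⌋-cong P⇔Q = does-⇔ P⇔Q lem lem

  not-⌊⌋ : not ⌊ P ⌋ ≡ ⌊ ¬ P ⌋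
  not-⌊⌋ = does-≡ (¬? lem) lem

  module _ (F : MonFrame) (s : S F) where

    Sub : Set
    Sub = Subset (S F)

    open Setoid (S F →-setoid Bool) using () renaming (sym to ≗-sym; trans to ≗-trans)
    open import Relation.Binary.Reasoning.Setoid (⇔-setoid 0ℓ)

    private variable
      A A′ B B′ C X Z Z′ : Sub
      u : S F
      f : Sub → Sub
      φ : μNML

    ≗⇒⊆ : A ≗ B → A ⊆ B
    ≗⇒⊆ A≗B u u∈A = trans (sym (A≗B u)) u∈A

    ⊆-refl : A ⊆ A
    ⊆-refl _ u∈A = u∈A

    ⊆-trans : A ⊆ B → B ⊆ C → A ⊆ C
    ⊆-trans A⊆B B⊆C u = B⊆C u ∘ A⊆B u

    ⊆-antisym : A ⊆ B → B ⊆ A → A ≗ B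
    ⊆-antisym {A} {B} A⊆B B⊆A u with A u in eqA | B u in eqB
    ... | true  | true  = refl
    ... | false | false = refl
    ... | true  | false = trans (sym (A⊆B u eqA)) eqB
    ... | false | true  = trans (sym eqA) (B⊆A u eqB)

    ∈-resp-≗ : A ≗ A′ → (u ∈ A) ⇔ (u ∈ A′)
    ∈-resp-≗ {u = u} A≗A′ = mk⇔ (≗⇒⊆ A≗A′ u) (≗⇒⊆ (≗-sym A≗A′) u)

    ⊆-resp-≗ : A ≗ A′ → B ≗ B′ → (A ⊆ B) ⇔ (A′ ⊆ B′)
    ⊆-resp-≗ A≗A′ B≗B′ = mk⇔
      (λ A⊆B → ⊆-trans (≗⇒⊆ (≗-sym A≗A′)) (⊆-trans A⊆B (≗⇒⊆ B≗B′)))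
      (λ A′⊆B′ → ⊆-trans (≗⇒⊆ A≗A′) (⊆-trans A′⊆B′ (≗⇒⊆ (≗-sym B≗B′))))

    ≗-resp-≗ : A ≗ A′ → B ≗ B′ → (A ≗ B) ⇔ (A′ ≗ B′)
    ≗-resp-≗ A≗A′ B≗B′ = mk⇔
      (λ A≗B → ≗-trans (≗-sym A≗A′) (≗-trans A≗B B≗B′))
      (λ A′≗B′ → ≗-trans A≗A′ (≗-trans A′≗B′ (≗-sym B≗B′)))

    ⊆⊇⇔≗ : (A ⊆ B × B ⊆ A) ⇔ (A ≗ B)
    ⊆⊇⇔≗ = mk⇔ (λ (A⊆B , B⊆A) → ⊆-antisym A⊆B B⊆A) (λ A≗B → ≗⇒⊆ A≗B , ≗⇒⊆ (≗-sym A≗B))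

    ⊆-by-subsets : (∀ Z → Z ⊆ A → Z ⊆ B) ⇔ (A ⊆ B)
    ⊆-by-subsets = mk⇔ (λ h → h _ ⊆-refl) (λ A⊆B Z Z⊆A → ⊆-trans Z⊆A A⊆B)

    ⊆-by-supersets : (∀ Z → B ⊆ Z → A ⊆ Z) ⇔ (A ⊆ B)
    ⊆-by-supersets = mk⇔ (λ h → h _ ⊆-refl) (λ A⊆B Z B⊆Z → ⊆-trans A⊆B B⊆Z)

    Empty : Sub → Set
    Empty Y = ∀ u → ¬ (u ∈ Y)

    ∅ : Sub
    ∅ _ = false

    ⊆-all⇔Empty : (∀ Z → A ⊆ Z) ⇔ Empty A
    ⊆-all⇔Empty = mk⇔
      (λ h u u∈A → case h ∅ u u∈A of λ ())
      (λ A-empty Z u u∈A → contradiction u∈A (A-empty u))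

    infixr 30 _∩_ _∪_

    _∩_ : Sub → Sub → Sub
    (A ∩ B) u = ⌊ (u ∈ A) × (u ∈ B) ⌋

    _∪_ : Sub → Sub → Sub
    (A ∪ B) u = ⌊ (u ∈ A) ⊎ (u ∈ B) ⌋

    ∁ : Sub → Sub
    ∁ A u = not (A u)

    ⟦□⟧ : Sub → Sub
    ⟦□⟧ A u = ⌊ σ F u A ⌋

    ⟦◇⟧ : Sub → Sub
    ⟦◇⟧ A u = ⌊ ¬ σ F u (∁ A) ⌋

    lfp : (Sub → Sub) → Sub
    lfp f u = ⌊ (∀ Z → f Z ⊆ Z → u ∈ Z) ⌋

    gfp : (Sub → Sub) → Sub
    gfp f u = ⌊ Σ Sub (λ Z → Z ⊆ f Z × u ∈ Z) ⌋

    ∩-cong : A ≗ A′ → B ≗ B′ → A ∩ B ≗ A′ ∩ B′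
    ∩-cong A≗A′ B≗B′ u = ⌊⌋-cong (∈-resp-≗ A≗A′ ×-⇔ ∈-resp-≗ B≗B′)

    ∪-cong : A ≗ A′ → B ≗ B′ → A ∪ B ≗ A′ ∪ B′
    ∪-cong A≗A′ B≗B′ u = ⌊⌋-cong (∈-resp-≗ A≗A′ ⊎-⇔ ∈-resp-≗ B≗B′)

    ∁-cong : A ≗ A′ → ∁ A ≗ ∁ A′
    ∁-cong A≗A′ = cong not ∘ A≗A′

    σ-resp-≗ : A ≗ A′ → σ F u A ⇔ σ F u A′
    σ-resp-≗ A≗A′ = mk⇔ (λ h → upward F h (≗⇒⊆ A≗A′)) (λ h → upward F h (≗⇒⊆ (≗-sym A≗A′)))

    ⟦□⟧-cong : A ≗ A′ → ⟦□⟧ A ≗ ⟦□⟧ A′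
    ⟦□⟧-cong A≗A′ u = ⌊⌋-cong (σ-resp-≗ A≗A′)

    ⟦◇⟧-cong : A ≗ A′ → ⟦◇⟧ A ≗ ⟦◇⟧ A′
    ⟦◇⟧-cong A≗A′ u = ⌊⌋-cong (¬-cong-⇔ (σ-resp-≗ (∁-cong A≗A′)))

    ⟦◇⟧≗∁⟦□⟧∁ : ⟦◇⟧ A ≗ ∁ (⟦□⟧ (∁ A))
    ⟦◇⟧≗∁⟦□⟧∁ u = sym not-⌊⌋

    lfp-cong : {f g : Sub → Sub} → (∀ Z → f Z ≗ g Z) → lfp f ≗ lfp g
    lfp-cong f≗g u = ⌊⌋-cong (mk⇔
      (λ h Z gZ⊆Z → h Z (⊆-trans (≗⇒⊆ (f≗g Z)) gZ⊆Z))
      (λ h Z fZ⊆Z → h Z (⊆-trans (≗⇒⊆ (≗-sym (f≗g Z))) fZ⊆Z)))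

    gfp-cong : {f g : Sub → Sub} → (∀ Z → f Z ≗ g Z) → gfp f ≗ gfp g
    gfp-cong f≗g u = ⌊⌋-cong (mk⇔
      (λ (Z , Z⊆fZ , u∈Z) → Z , ⊆-trans Z⊆fZ (≗⇒⊆ (f≗g Z)) , u∈Z)
      (λ (Z , Z⊆gZ , u∈Z) → Z , ⊆-trans Z⊆gZ (≗⇒⊆ (≗-sym (f≗g Z))) , u∈Z))

    ⊆-∩ : (X ⊆ A × X ⊆ B) ⇔ (X ⊆ A ∩ B)
    ⊆-∩ = mk⇔
      (λ (X⊆A , X⊆B) u u∈X → from ⌊⌋-true (X⊆A u u∈X , X⊆B u u∈X))
      (λ X⊆A∩B → (λ u → proj₁ ∘ to ⌊⌋-true ∘ X⊆A∩B u) , (λ u → proj₂ ∘ to ⌊⌋-true ∘ X⊆A∩B u))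

    ∪-⊆ : (A ⊆ X × B ⊆ X) ⇔ (A ∪ B ⊆ X)
    ∪-⊆ = mk⇔
      (λ (A⊆X , B⊆X) u u∈A∪B → [ A⊆X u , B⊆X u ]′ (to ⌊⌋-true u∈A∪B))
      (λ A∪B⊆X → (λ u → A∪B⊆X u ∘ from ⌊⌋-true ∘ inj₁) , (λ u → A∪B⊆X u ∘ from ⌊⌋-true ∘ inj₂))

    ⊆-lfp : (∀ Z → f Z ⊆ Z → X ⊆ Z) ⇔ (X ⊆ lfp f)
    ⊆-lfp = mk⇔
      (λ h u u∈X → from ⌊⌋-true (λ Z fZ⊆Z → h Z fZ⊆Z u u∈X))
      (λ X⊆lfp Z fZ⊆Z u u∈X → to ⌊⌋-true (X⊆lfp u u∈X) Z fZ⊆Z)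

    gfp-⊆ : (∀ Z → Z ⊆ f Z → Z ⊆ X) ⇔ (gfp f ⊆ X)
    gfp-⊆ {f = f} = mk⇔
      (λ h u u∈gfp → let (Z , Z⊆fZ , u∈Z) = to (⌊⌋-true {Σ Sub λ Z → Z ⊆ f Z × u ∈ Z}) u∈gfp
                     in h Z Z⊆fZ u u∈Z)
      (λ gfp⊆X Z Z⊆fZ u u∈Z → gfp⊆X u (from ⌊⌋-true (Z , Z⊆fZ , u∈Z)))

    ⊆-⟦□⟧ : (∀ t → t ∈ X → σ F t A) ⇔ (X ⊆ ⟦□⟧ A)
    ⊆-⟦□⟧ = mk⇔ (λ h u → from ⌊⌋-true ∘ h u) (λ X⊆□A t → to ⌊⌋-true ∘ X⊆□A t)

    disjoint⇔⊆∁ : (∀ Y → (Y ⊆ X × Y ⊆ A) → Empty Y) ⇔ (X ⊆ ∁ A)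
    disjoint⇔⊆∁ {X} {A} = mk⇔ ⊆∁
      (λ X⊆∁A Y (Y⊆X , Y⊆A) u u∈Y → ∈-and-∉ (Y⊆A u u∈Y) (X⊆∁A u (Y⊆X u u∈Y)))
      where
      ∈-and-∉ : ∀ {b} → b ≡ true → not b ≡ true → ⊥
      ∈-and-∉ refl ()
      ⊆∁ : (∀ Y → (Y ⊆ X × Y ⊆ A) → Empty Y) → X ⊆ ∁ A
      ⊆∁ h u u∈X with A u in u∈A
      ... | true  = contradiction (from ⌊⌋-true (u∈X , u∈A)) (h (X ∩ A) (from ⊆-∩ ⊆-refl) u)
      ... | false = refl

    infixl 40 _[_↦_]

    -- Update and satisfaction are opaque so that they do not unfold into
    -- `if_then_else_` and `Defs` clauses, which would block inference of
    -- the implicit arguments of the lemmas about them.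
    opaque
      _[_↦_] : Valuation F → Var → Sub → Valuation F
      _[_↦_] = Defs._[_↦_] {F}

    ⟦_⟧ : μNML → Valuation F → Sub
    ⟦ φ ⟧ V = ext lem F V φ

    private variable
      V V′ : Valuation F
      a b k p q x y w : Var

    opaque
      unfolding _[_↦_]

      update-same : (V [ x ↦ Z ]) x ≗ Z
      update-same {x = x} with x ≡ᵇ x | ≡⇒≡ᵇ x x refl
      ... | true  | _ = λ _ → refl
      ... | false | ()

      update-other : q ≢ x → (V [ x ↦ Z ]) q ≗ V q
      update-other {q = q} {x = x} q≢x with q ≡ᵇ x | ≡ᵇ⇒≡ q x
      ... | true  | q≡x = contradiction (q≡x tt) q≢x
      ... | false | _   = λ _ → refl

      update-cong : ∀ r → Z ≗ Z′ → V r ≗ V′ r → (V [ x ↦ Z ]) r ≗ (V′ [ x ↦ Z′ ]) r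
      update-cong {x = x} r Z≗Z′ Vr≗V′r with r ≡ᵇ x
      ... | true  = Z≗Z′
      ... | false = Vr≗V′r

      ⟦μ′⟧ : ⟦ μ′ q φ ⟧ V ≡ lfp (λ Z → ⟦ φ ⟧ (V [ q ↦ Z ]))
      ⟦μ′⟧ = refl

      ⟦ν′⟧ : ⟦ ν′ q φ ⟧ V ≡ gfp (λ Z → ⟦ φ ⟧ (V [ q ↦ Z ]))
      ⟦ν′⟧ = refl

    _≋_ : Valuation F → Valuation F → Set
    V ≋ V′ = ∀ q → V q ≗ V′ q

    update-≋ : V ≋ V′ → Z ≗ Z′ → V [ x ↦ Z ] ≋ V′ [ x ↦ Z′ ]
    update-≋ V≋V′ Z≗Z′ r = update-cong r Z≗Z′ (V≋V′ r)

    Agree : ℕ → Valuation F → Valuation F → Set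
    Agree k V V′ = ∀ r → r < k → V r ≗ V′ r

    agree-update : Agree k V V′ → Agree k (V [ x ↦ Z ]) (V′ [ x ↦ Z ])
    agree-update V≈V′ r r<k = update-cong r (λ _ → refl) (V≈V′ r r<k)

    agree-fresh : k ≤ x → Agree k (V [ x ↦ Z ]) V
    agree-fresh k≤x r r<k = update-other (<⇒≢ (<-≤-trans r<k k≤x))

    Local : ℕ → (Valuation F → Sub) → Set
    Local k T = ∀ {V V′} → Agree k V V′ → T V ≗ T V′

    var-local : {G : Sub → Sub} → (∀ {A A′} → A ≗ A′ → G A ≗ G A′) → a < k → Local k (λ V → G (V a))
    var-local G-cong a<k V≈V′ = G-cong (V≈V′ _ a<k)

    opaque
      unfolding _[_↦_]

      ⟦⟧-local : ∀ φ → Below k φ → Local k ⟦ φ ⟧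
      ⟦⟧-local (var q)  q<k       V≈V′ = V≈V′ q q<k
      ⟦⟧-local (nvar q) q<k       V≈V′ = ∁-cong (V≈V′ q q<k)
      ⟦⟧-local (φ ∧′ ψ) (bφ , bψ) V≈V′ = ∩-cong (⟦⟧-local φ bφ V≈V′) (⟦⟧-local ψ bψ V≈V′)
      ⟦⟧-local (φ ∨′ ψ) (bφ , bψ) V≈V′ = ∪-cong (⟦⟧-local φ bφ V≈V′) (⟦⟧-local ψ bψ V≈V′)
      ⟦⟧-local (□′ φ)   bφ        V≈V′ = ⟦□⟧-cong (⟦⟧-local φ bφ V≈V′)
      ⟦⟧-local (◇′ φ)   bφ        V≈V′ = ⟦◇⟧-cong (⟦⟧-local φ bφ V≈V′)
      ⟦⟧-local (μ′ q φ) (_ , bφ)  V≈V′ = lfp-cong (λ Z → ⟦⟧-local φ bφ (agree-update V≈V′))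
      ⟦⟧-local (ν′ q φ) (_ , bφ)  V≈V′ = gfp-cong (λ Z → ⟦⟧-local φ bφ (agree-update V≈V′))

    infix 4 _⊩_

    opaque
      _⊩_ : Valuation F → NMSO → Set
      V ⊩ χ = F ⊨ V , s ⊢ χ

    private variable
      α β γ χ ξ : NMSO
      T T′ T₁ T₂ : Valuation F → Sub

    opaque
      unfolding _⊩_ _[_↦_]

      ⊨⇔⊩ : (F ⊨ V , s ⊢ χ) ⇔ (V ⊩ χ)
      ⊨⇔⊩ = mk⇔ id id

      ⊩-⊆ : V ⊩ (p ⊆′ q) ⇔ (V p ⊆ V q)
      ⊩-⊆ = mk⇔ id id

      ⊩-□² : V ⊩ □² p q ⇔ (∀ t → t ∈ V p → σ F t (V q))
      ⊩-□² = mk⇔ id id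

      ⊩-∧ : V ⊩ (χ ∧ₘ ξ) ⇔ (V ⊩ χ × V ⊩ ξ)
      ⊩-∧ = mk⇔ id id

      ⊩-∃ : V ⊩ ∃ₘ x χ ⇔ Σ Sub (λ Z → V [ x ↦ Z ] ⊩ χ)
      ⊩-∃ = mk⇔ id id

      ⊩-⇒ : V ⊩ (χ ⇒ₘ ξ) ⇔ (V ⊩ χ → V ⊩ ξ)
      ⊩-⇒ {V = V} {χ = χ} {ξ = ξ} = mk⇔ [ (λ ¬χ χ → contradiction χ ¬χ) , (λ ξ _ → ξ) ]′ fromImplication
        where
        fromImplication : (V ⊩ χ → V ⊩ ξ) → V ⊩ (χ ⇒ₘ ξ)
        fromImplication χ→ξ with lem {V ⊩ χ}
        ... | yes χ = inj₂ (χ→ξ χ)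
        ... | no ¬χ = inj₁ ¬χ

      ⊩-∀ : V ⊩ ∀ₘ x χ ⇔ (∀ Z → V [ x ↦ Z ] ⊩ χ)
      ⊩-∀ = mk⇔ (λ h Z → em⇒dne lem (λ ¬χ → h (Z , ¬χ))) (λ h (Z , ¬χ) → ¬χ (h Z))

      ⊩-resp-≋ : ∀ χ → V ≋ V′ → V ⊩ χ → V′ ⊩ χ
      ⊩-resp-≋ (sr p)   V≋V′ h u       = proj₁ (h u) ∘ ≗⇒⊆ (≗-sym (V≋V′ p)) u
                                       , ≗⇒⊆ (V≋V′ p) u ∘ proj₂ (h u)
      ⊩-resp-≋ (p ⊆′ q) V≋V′ h         = to (⊆-resp-≗ (V≋V′ p) (V≋V′ q)) h
      ⊩-resp-≋ (□² p q) V≋V′ h t t∈Vp  = upward F (h t (≗⇒⊆ (≗-sym (V≋V′ p)) t t∈Vp)) (≗⇒⊆ (V≋V′ q))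
      ⊩-resp-≋ (χ ∨ₘ ξ) V≋V′ (inj₁ h)  = inj₁ (⊩-resp-≋ χ V≋V′ h)
      ⊩-resp-≋ (χ ∨ₘ ξ) V≋V′ (inj₂ h)  = inj₂ (⊩-resp-≋ ξ V≋V′ h)
      ⊩-resp-≋ (χ ∧ₘ ξ) V≋V′ (hχ , hξ) = ⊩-resp-≋ χ V≋V′ hχ , ⊩-resp-≋ ξ V≋V′ hξ
      ⊩-resp-≋ (¬ₘ χ)   V≋V′ h h′      = h (⊩-resp-≋ χ (λ q → ≗-sym (V≋V′ q)) h′)
      ⊩-resp-≋ (∃ₘ x χ) V≋V′ (Z , h)   = Z , ⊩-resp-≋ χ (update-≋ V≋V′ (λ _ → refl)) h

    Pins : Valuation F → Var → NMSO → Sub → Set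
    Pins V x α A = ∀ Z → V [ x ↦ Z ] ⊩ α ⇔ (Z ≗ A)

    ⊩-Let : Pins V x α A → V ⊩ Let x α β ⇔ V [ x ↦ A ] ⊩ β
    ⊩-Let {A = A} {β = β} pin = mk⇔
      (λ h → let (Z , hαβ) = to ⊩-∃ h ; (hα , hβ) = to ⊩-∧ hαβ
             in ⊩-resp-≋ β (update-≋ (λ _ _ → refl) (to (pin Z) hα)) hβ)
      (λ hβ → from ⊩-∃ (A , from ⊩-∧ (from (pin A) (λ _ → refl) , hβ)))

    ⊩-∀-pinned : Pins V x α A → V ⊩ ∀ₘ x (α ⇒ₘ β) ⇔ V [ x ↦ A ] ⊩ β
    ⊩-∀-pinned {A = A} {β = β} pin = mk⇔
      (λ h → to ⊩-⇒ (to ⊩-∀ h A) (from (pin A) (λ _ → refl)))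
      (λ hβ → from ⊩-∀ λ Z → from ⊩-⇒ λ hα →
        ⊩-resp-≋ β (update-≋ (λ _ _ → refl) (≗-sym (to (pin Z) hα))) hβ)

    Defines : NMSO → Var → (Valuation F → Sub) → Set
    Defines χ p T = ∀ V → V ⊩ χ ⇔ (V p ≗ T V)

    Defines-resp : (∀ V → T V ≗ T′ V) → Defines χ p T → Defines χ p T′
    Defines-resp T≗T′ χ-def V = ≗-resp-≗ (λ _ → refl) (T≗T′ V) ⇔-∘ χ-def V

    defines⇒pins : Defines α x T → Local k T → k ≤ x → Pins V x α (T V)
    defines⇒pins {α = α} {x = x} {T = T} {V = V} α-def T-local k≤x Z = begin
      V [ x ↦ Z ] ⊩ α                     ≈⟨ α-def (V [ x ↦ Z ]) ⟩
      (V [ x ↦ Z ]) x ≗ T (V [ x ↦ Z ])    ≈⟨ ≗-resp-≗ update-same (T-local (agree-fresh k≤x)) ⟩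
      Z ≗ T V                             ∎

    Let-defines : {R : Valuation F → Sub} → Defines α x T → Local k T → k ≤ x → Defines β p R → p ≢ x →
      Defines (Let x α β) p (λ V → R (V [ x ↦ T V ]))
    Let-defines {α = α} {x = x} {T = T} {β = β} {p = p} {R = R} α-def T-local k≤x β-def p≢x V = begin
      V ⊩ Let x α β                           ≈⟨ ⊩-Let (defines⇒pins α-def T-local k≤x) ⟩
      V [ x ↦ T V ] ⊩ β                       ≈⟨ β-def (V [ x ↦ T V ]) ⟩
      (V [ x ↦ T V ]) p ≗ R (V [ x ↦ T V ])   ≈⟨ ≗-resp-≗ (update-other p≢x) (λ _ → refl) ⟩
      V p ≗ R (V [ x ↦ T V ])                 ∎

    Let-defines-map : {G : Sub → Sub} → (∀ {A A′} → A ≗ A′ → G A ≗ G A′) →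
      Defines α k T → Local k T → Defines β p (λ V → G (V k)) → p < k →
      Defines (Let k α β) p (G ∘ T)
    Let-defines-map G-cong α-def T-local β-def p<k =
      Defines-resp (λ V → G-cong update-same) (Let-defines α-def T-local ≤-refl β-def (<⇒≢ p<k))

    Let-defines-map₂ : {G : Sub → Sub → Sub} → (∀ {A A′ B B′} → A ≗ A′ → B ≗ B′ → G A B ≗ G A′ B′) →
      Defines α k T₁ → Local k T₁ → Defines β (1 + k) T₂ → Local k T₂ →
      Defines γ p (λ V → G (V k) (V (1 + k))) → p < k →
      Defines (Let k α (Let (1 + k) β γ)) p (λ V → G (T₁ V) (T₂ V))
    Let-defines-map₂ {k = k} {β = β} {T₂ = T₂} {γ = γ} {p = p} {G = G}
                     G-cong α-def T₁-local β-def T₂-local γ-def p<k =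
      Defines-resp (λ V → G-cong update-same (T₂-local (agree-fresh ≤-refl)))
        (Let-defines α-def T₁-local ≤-refl inner (<⇒≢ p<k))
      where
      inner : Defines (Let (1 + k) β γ) p (λ V → G (V k) (T₂ V))
      inner = Defines-resp (λ V → G-cong (update-other (<⇒≢ (n<1+n k))) update-same)
                (Let-defines β-def T₂-local (n≤1+n k) γ-def (<⇒≢ (m<n⇒m<1+n p<k)))

    -- Set operations definable in NMSO

    ≐ₘ-defines : Defines (x ≐ₘ p) x (λ V → V p)
    ≐ₘ-defines {x = x} {p = p} V = begin
      V ⊩ (x ≐ₘ p)                      ≈⟨ ⊩-∧ ⟩
      (V ⊩ (x ⊆′ p) × V ⊩ (p ⊆′ x))     ≈⟨ ⊩-⊆ ×-⇔ ⊩-⊆ ⟩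
      (V x ⊆ V p × V p ⊆ V x)           ≈⟨ ⊆⊇⇔≗ ⟩
      V x ≗ V p                         ∎

    ≐ₘ-pins : p < x → Pins V x (x ≐ₘ p) (V p)
    ≐ₘ-pins {p = p} p<x = defines⇒pins ≐ₘ-defines (var-local id (n<1+n p)) p<x

    ⊩-fresh-⊆ : a < x → V [ x ↦ Z ] ⊩ (x ⊆′ a) ⇔ (Z ⊆ V a)
    ⊩-fresh-⊆ a<x = ⊆-resp-≗ update-same (update-other (<⇒≢ a<x)) ⇔-∘ ⊩-⊆

    ⊩-⊆-fresh : a < x → V [ x ↦ Z ] ⊩ (a ⊆′ x) ⇔ (V a ⊆ Z)
    ⊩-⊆-fresh a<x = ⊆-resp-≗ (update-other (<⇒≢ a<x)) update-same ⇔-∘ ⊩-⊆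

    ⊩-IsGreatest : p < x → (∀ Z → V [ x ↦ Z ] ⊩ χ ⇔ (Z ⊆ A)) → V ⊩ IsGreatest p x χ ⇔ (V p ≗ A)
    ⊩-IsGreatest {p = p} {x = x} {V = V} {χ = χ} {A = A} p<x χ⇔⊆A = begin
      V ⊩ IsGreatest p x χ
        ≈⟨ ⊩-∧ ⟩
      (V ⊩ ∃ₘ x ((x ≐ₘ p) ∧ₘ χ) × V ⊩ ∀ₘ x (χ ⇒ₘ (x ⊆′ p)))
        ≈⟨ (χ⇔⊆A (V p) ⇔-∘ ⊩-Let (≐ₘ-pins p<x)) ×-⇔ upper ⟩
      (V p ⊆ A × A ⊆ V p)
        ≈⟨ ⊆⊇⇔≗ ⟩
      V p ≗ A
        ∎
      where
      upper : V ⊩ ∀ₘ x (χ ⇒ₘ (x ⊆′ p)) ⇔ (A ⊆ V p)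
      upper = begin
        V ⊩ ∀ₘ x (χ ⇒ₘ (x ⊆′ p))
          ≈⟨ ⊩-∀ ⟩
        (∀ Z → V [ x ↦ Z ] ⊩ χ ⇒ₘ (x ⊆′ p))
          ≈⟨ Π-cong-⇔ (λ Z → →-cong-⇔ (χ⇔⊆A Z) (⊩-fresh-⊆ p<x) ⇔-∘ ⊩-⇒) ⟩
        (∀ Z → Z ⊆ A → Z ⊆ V p)
          ≈⟨ ⊆-by-subsets ⟩
        A ⊆ V p
          ∎

    ⊩-IsLeast : p < x → (∀ Z → V [ x ↦ Z ] ⊩ χ ⇔ (A ⊆ Z)) → V ⊩ IsLeast p x χ ⇔ (V p ≗ A)
    ⊩-IsLeast {p = p} {x = x} {V = V} {χ = χ} {A = A} p<x χ⇔A⊆ = begin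
      V ⊩ IsLeast p x χ
        ≈⟨ ⊩-∧ ⟩
      (V ⊩ ∀ₘ x (χ ⇒ₘ (p ⊆′ x)) × V ⊩ ∃ₘ x ((x ≐ₘ p) ∧ₘ χ))
        ≈⟨ lower ×-⇔ (χ⇔A⊆ (V p) ⇔-∘ ⊩-Let (≐ₘ-pins p<x)) ⟩
      (V p ⊆ A × A ⊆ V p)
        ≈⟨ ⊆⊇⇔≗ ⟩
      V p ≗ A
        ∎
      where
      lower : V ⊩ ∀ₘ x (χ ⇒ₘ (p ⊆′ x)) ⇔ (V p ⊆ A)
      lower = begin
        V ⊩ ∀ₘ x (χ ⇒ₘ (p ⊆′ x))
          ≈⟨ ⊩-∀ ⟩
        (∀ Z → V [ x ↦ Z ] ⊩ χ ⇒ₘ (p ⊆′ x))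
          ≈⟨ Π-cong-⇔ (λ Z → →-cong-⇔ (χ⇔A⊆ Z) (⊩-⊆-fresh p<x) ⇔-∘ ⊩-⇒) ⟩
        (∀ Z → A ⊆ Z → V p ⊆ Z)
          ≈⟨ ⊆-by-supersets ⟩
        V p ⊆ A
          ∎

    ⊩-IsEmpty : y < w → V [ y ↦ Z ] ⊩ IsEmpty y w ⇔ Empty Z
    ⊩-IsEmpty {y = y} {w = w} {V = V} {Z = Z} y<w = begin
      V [ y ↦ Z ] ⊩ IsEmpty y w
        ≈⟨ ⊩-∀ ⟩
      (∀ W → V [ y ↦ Z ] [ w ↦ W ] ⊩ (y ⊆′ w))
        ≈⟨ Π-cong-⇔ (λ W → ⊆-resp-≗ update-same (λ _ → refl) ⇔-∘ ⊩-⊆-fresh y<w) ⟩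
      (∀ W → Z ⊆ W)
        ≈⟨ ⊆-all⇔Empty ⟩
      Empty Z
        ∎

    ⊩-Disjoint : x < y → a < y → y < w → V ⊩ Disjoint x a y w ⇔ (V x ⊆ ∁ (V a))
    ⊩-Disjoint {x = x} {y = y} {a = a} {w = w} {V = V} x<y a<y y<w = begin
      V ⊩ Disjoint x a y w
        ≈⟨ ⊩-∀ ⟩
      (∀ Y → V [ y ↦ Y ] ⊩ ((y ⊆′ x) ∧ₘ (y ⊆′ a)) ⇒ₘ IsEmpty y w)
        ≈⟨ Π-cong-⇔ (λ Y → →-cong-⇔ common (⊩-IsEmpty y<w) ⇔-∘ ⊩-⇒) ⟩
      (∀ Y → (Y ⊆ V x × Y ⊆ V a) → Empty Y)
        ≈⟨ disjoint⇔⊆∁ ⟩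
      V x ⊆ ∁ (V a)
        ∎
      where
      common : ∀ {Y} → V [ y ↦ Y ] ⊩ (y ⊆′ x) ∧ₘ (y ⊆′ a) ⇔ (Y ⊆ V x × Y ⊆ V a)
      common = (⊩-fresh-⊆ x<y ×-⇔ ⊩-fresh-⊆ a<y) ⇔-∘ ⊩-∧

    IsInter-defines : p < k → a < k → b < k → Defines (IsInter p a b k) p (λ V → V a ∩ V b)
    IsInter-defines p<k a<k b<k V = ⊩-IsGreatest p<k λ Z →
      ⊆-∩ ⇔-∘ ((⊩-fresh-⊆ a<k ×-⇔ ⊩-fresh-⊆ b<k) ⇔-∘ ⊩-∧)

    IsUnion-defines : p < k → a < k → b < k → Defines (IsUnion p a b k) p (λ V → V a ∪ V b)
    IsUnion-defines p<k a<k b<k V = ⊩-IsLeast p<k λ Z →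
      ∪-⊆ ⇔-∘ ((⊩-⊆-fresh a<k ×-⇔ ⊩-⊆-fresh b<k) ⇔-∘ ⊩-∧)

    IsCompl-defines : p < k → a < k → Defines (IsCompl p a k) p (λ V → ∁ (V a))
    IsCompl-defines {k = k} p<k a<k V = ⊩-IsGreatest p<k λ Z →
      ⊆-resp-≗ update-same (∁-cong (update-other (<⇒≢ a<k)))
        ⇔-∘ ⊩-Disjoint (n<1+n k) (m<n⇒m<1+n a<k) (n<1+n (1 + k))

    Is□-defines : p < k → a < k → Defines (Is□ p a k) p (λ V → ⟦□⟧ (V a))
    Is□-defines p<k a<k V = ⊩-IsGreatest p<k λ Z →
      ⊆-⟦□⟧ ⇔-∘ (Π-cong-⇔ (λ t → →-cong-⇔ (∈-resp-≗ update-same) (σ-resp-≗ (update-other (<⇒≢ a<k))))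
                 ⇔-∘ ⊩-□²)

    Is◇-defines : p < k → a < k → Defines (Is◇ p a k) p (λ V → ⟦◇⟧ (V a))
    Is◇-defines {p = p} {k = k} p<k a<k =
      Defines-resp (λ V → ≗-sym ⟦◇⟧≗∁⟦□⟧∁)
        (Let-defines-map (∁-cong ∘ ⟦□⟧-cong)
          (IsCompl-defines (n<1+n k) (m<n⇒m<1+n a<k)) (var-local ∁-cong a<k) ∁□-defines p<k)
      where
      ∁□-defines : Defines (Let (1 + k) (Is□ (1 + k) k (2 + k)) (IsCompl p (1 + k) (2 + k)))
                           p (λ V → ∁ (⟦□⟧ (V k)))
      ∁□-defines = Let-defines-map ∁-cong
        (Is□-defines (n<1+n (1 + k)) (k<2+k k)) (var-local ⟦□⟧-cong (n<1+n k))
        (IsCompl-defines (m<n⇒m<1+n (m<n⇒m<1+n p<k)) (n<1+n (1 + k))) (m<n⇒m<1+n p<k)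

    -- Fixpoints

    ⊩-∀∀-Eq : ∀ φ → Below k φ → Defines (Eq φ (1 + k) (2 + k)) (1 + k) ⟦ φ ⟧ →
      V ⊩ ∀ₘ q (∀ₘ (1 + k) (Eq φ (1 + k) (2 + k) ⇒ₘ ξ))
        ⇔ (∀ Z → V [ q ↦ Z ] [ 1 + k ↦ ⟦ φ ⟧ (V [ q ↦ Z ]) ] ⊩ ξ)
    ⊩-∀∀-Eq {k = k} φ bφ φ-def =
      Π-cong-⇔ (λ Z → ⊩-∀-pinned (defines⇒pins φ-def (⟦⟧-local φ bφ) (n≤1+n k))) ⇔-∘ ⊩-∀

    fixpoint-reads : ∀ φ → Below k φ → q < k →
      let W = V [ k ↦ X ] [ q ↦ Z ] [ 1 + k ↦ ⟦ φ ⟧ (V [ k ↦ X ] [ q ↦ Z ]) ] in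
      (W (1 + k) ≗ ⟦ φ ⟧ (V [ q ↦ Z ])) × (W q ≗ Z) × (W k ≗ X)
    fixpoint-reads {k = k} φ bφ q<k =
        ≗-trans update-same (⟦⟧-local φ bφ (agree-update (agree-fresh ≤-refl)))
      , ≗-trans (update-other (<⇒≢ (m<n⇒m<1+n q<k))) update-same
      , ≗-trans (update-other (<⇒≢ (n<1+n k))) (≗-trans (update-other (>⇒≢ q<k)) update-same)

    ⊩-BelowPrefixed : ∀ φ → Below k φ → q < k → Defines (Eq φ (1 + k) (2 + k)) (1 + k) ⟦ φ ⟧ →
      V [ k ↦ X ] ⊩ BelowPrefixed q φ k ⇔ (X ⊆ ⟦ μ′ q φ ⟧ V)
    ⊩-BelowPrefixed {k = k} {q = q} {V = V} {X = X} φ bφ q<k φ-def = begin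
      V [ k ↦ X ] ⊩ BelowPrefixed q φ k
        ≈⟨ Π-cong-⇔ prefixed ⇔-∘ ⊩-∀∀-Eq φ bφ φ-def ⟩
      (∀ Z → ⟦ φ ⟧ (V [ q ↦ Z ]) ⊆ Z → X ⊆ Z)
        ≈⟨ ⊆-lfp ⟩
      X ⊆ lfp (λ Z → ⟦ φ ⟧ (V [ q ↦ Z ]))
        ≈⟨ ⊆-resp-≗ (λ _ → refl) (cong-app (sym (⟦μ′⟧ {q = q} {φ = φ} {V = V}))) ⟩
      X ⊆ ⟦ μ′ q φ ⟧ V
        ∎
      where
      prefixed : ∀ Z → V [ k ↦ X ] [ q ↦ Z ] [ 1 + k ↦ ⟦ φ ⟧ (V [ k ↦ X ] [ q ↦ Z ]) ]
                         ⊩ ((1 + k) ⊆′ q) ⇒ₘ (k ⊆′ q)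
                       ⇔ (⟦ φ ⟧ (V [ q ↦ Z ]) ⊆ Z → X ⊆ Z)
      prefixed Z = let (φ≗ , q≗ , k≗) = fixpoint-reads {V = V} {X = X} {Z = Z} φ bφ q<k in
        →-cong-⇔ (⊆-resp-≗ φ≗ q≗ ⇔-∘ ⊩-⊆) (⊆-resp-≗ k≗ q≗ ⇔-∘ ⊩-⊆) ⇔-∘ ⊩-⇒

    ⊩-AbovePostfixed : ∀ φ → Below k φ → q < k → Defines (Eq φ (1 + k) (2 + k)) (1 + k) ⟦ φ ⟧ →
      V [ k ↦ X ] ⊩ AbovePostfixed q φ k ⇔ (⟦ ν′ q φ ⟧ V ⊆ X)
    ⊩-AbovePostfixed {k = k} {q = q} {V = V} {X = X} φ bφ q<k φ-def = begin
      V [ k ↦ X ] ⊩ AbovePostfixed q φ k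
        ≈⟨ Π-cong-⇔ postfixed ⇔-∘ ⊩-∀∀-Eq φ bφ φ-def ⟩
      (∀ Z → Z ⊆ ⟦ φ ⟧ (V [ q ↦ Z ]) → Z ⊆ X)
        ≈⟨ gfp-⊆ ⟩
      gfp (λ Z → ⟦ φ ⟧ (V [ q ↦ Z ])) ⊆ X
        ≈⟨ ⊆-resp-≗ (cong-app (sym (⟦ν′⟧ {q = q} {φ = φ} {V = V}))) (λ _ → refl) ⟩
      ⟦ ν′ q φ ⟧ V ⊆ X
        ∎
      where
      postfixed : ∀ Z → V [ k ↦ X ] [ q ↦ Z ] [ 1 + k ↦ ⟦ φ ⟧ (V [ k ↦ X ] [ q ↦ Z ]) ]
                          ⊩ (q ⊆′ (1 + k)) ⇒ₘ (q ⊆′ k)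
                        ⇔ (Z ⊆ ⟦ φ ⟧ (V [ q ↦ Z ]) → Z ⊆ X)
      postfixed Z = let (φ≗ , q≗ , k≗) = fixpoint-reads {V = V} {X = X} {Z = Z} φ bφ q<k in
        →-cong-⇔ (⊆-resp-≗ q≗ φ≗ ⇔-∘ ⊩-⊆) (⊆-resp-≗ q≗ k≗ ⇔-∘ ⊩-⊆) ⇔-∘ ⊩-⇒

    -- Correctness of the translation

    Eq-defines : ∀ φ → Below k φ → a < k → Defines (Eq φ a k) a ⟦ φ ⟧
    Eq-defines (var q)  q<k a<k = ≐ₘ-defines
    Eq-defines (nvar q) q<k a<k = IsCompl-defines a<k q<k
    Eq-defines {k = k} (φ ∧′ ψ) (bφ , bψ) a<k =
      Let-defines-map₂ ∩-cong
        (Eq-defines φ (Below-mono φ (k≤2+k k) bφ) (k<2+k k)) (⟦⟧-local φ bφ)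
        (Eq-defines ψ (Below-mono ψ (k≤2+k k) bψ) (n<1+n (1 + k))) (⟦⟧-local ψ bψ)
        (IsInter-defines (<-≤-trans a<k (k≤2+k k)) (k<2+k k) (n<1+n (1 + k))) a<k
    Eq-defines {k = k} (φ ∨′ ψ) (bφ , bψ) a<k =
      Let-defines-map₂ ∪-cong
        (Eq-defines φ (Below-mono φ (k≤2+k k) bφ) (k<2+k k)) (⟦⟧-local φ bφ)
        (Eq-defines ψ (Below-mono ψ (k≤2+k k) bψ) (n<1+n (1 + k))) (⟦⟧-local ψ bψ)
        (IsUnion-defines (<-≤-trans a<k (k≤2+k k)) (k<2+k k) (n<1+n (1 + k))) a<k
    Eq-defines {k = k} (□′ φ) bφ a<k =
      Let-defines-map ⟦□⟧-cong (Eq-defines φ (Below-mono φ (n≤1+n k) bφ) (n<1+n k)) (⟦⟧-local φ bφ)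
        (Is□-defines (m<n⇒m<1+n a<k) (n<1+n k)) a<k
    Eq-defines {k = k} (◇′ φ) bφ a<k =
      Let-defines-map ⟦◇⟧-cong (Eq-defines φ (Below-mono φ (n≤1+n k) bφ) (n<1+n k)) (⟦⟧-local φ bφ)
        (Is◇-defines (m<n⇒m<1+n a<k) (n<1+n k)) a<k
    Eq-defines {k = k} (μ′ q φ) (q<k , bφ) a<k V = ⊩-IsGreatest a<k λ X →
      ⊩-BelowPrefixed φ bφ q<k (Eq-defines φ (Below-mono φ (k≤2+k k) bφ) (n<1+n (1 + k)))
    Eq-defines {k = k} (ν′ q φ) (q<k , bφ) a<k V = ⊩-IsLeast a<k λ X →
      ⊩-AbovePostfixed φ bφ q<k (Eq-defines φ (Below-mono φ (k≤2+k k) bφ) (n<1+n (1 + k)))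

mainTheorem1 : (lem : ExcludedMiddle 0ℓ) → (φ : μNML) → (p : Var) →
    Σ NMSO (λ Eq → (F : MonFrame) → (V : Valuation F) → (s : S F) →
      ((F ⊨ V , s ⊢ Eq) ⇔ (∀ u → V p u ≡ ext lem F V φ u)))
mainTheorem1 lem φ p = Eq φ p k , λ F V s → Eq-defines lem F s φ bφ p<k V ⇔-∘ ⊨⇔⊩ lem F s
  where
  k = suc p ⊔ bound φ
  p<k : p < k
  p<k = m≤m⊔n (suc p) (bound φ)
  bφ : Below k φ
  bφ = Below-mono φ (m≤n⊔m (suc p) (bound φ)) (Below-bound φ)
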